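{- Let $G$ be an infinite group, $\mathcal{I}$ a proper translation invariant ideal of $G$, and $A$ a subset of $G$. If $A$ is not $\mathcal{I}$-small, then $A$ is $\Delta_{\mathcal{I}}$-large.
   Context: A family $\mathcal{I}\subseteq\mathcal{P}(G)$ is an ideal if it is closed under taking subsets and finite unions; it is translation invariant if $gI=\{gi: i\in I\}\in\mathcal{I}$ for all $I\in\mathcal{I}$, $g\in G$; it is proper if $G\notin\mathcal{I}$. For subsets $A,B\subseteq G$ write $A=_{\mathcal{I}}B$ if the symmetric difference $A\triangle B\in\mathcal{I}$. A subset $A\subseteq G$ is $\mathcal{I}$-large if there is a finite $F\subseteq G$ with $FA=_{\mathcal{I}}G$ (where $FA=\{fa: f\in F,a\in A\}$); $\mathcal{I}$-small if $(G\setminus A)\cap L$ is $\mathcal{I}$-large for every $\mathcal{I}$-large $L\subseteq G$. Define $\Delta_{\mathcal{I}}(A)=\{g\in G: gA\cap A\notin\mathcal{I}\}$, and call $A$ $\Delta_{\mathcal{I}}$-large if $\Delta_{\mathcal{I}}(A)$ is $\mathcal{I}$-large. -}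

module Defs where

open import Level using (0ℓ)
open import Data.Product using (Σ; ∃; _×_; _,_)
open import Data.Sum using (_⊎_)
open import Data.List using (List)
open import Data.List.Membership.Propositional using (_∈_)
open import Relation.Nullary using (¬_)
open import Relation.Unary using (Pred; _⊆_; _∩_; _∪_; ∁; ∅; U)
open import Relation.Binary.PropositionalEquality using (_≡_)
open import Algebra.Structures using (IsGroup)

Subset : Set → Set₁
Subset G = Pred G 0ℓ

Family : Set → Set₁
Family G = Pred (Subset G) 0ℓ

Infinite : Set → Set
Infinite G = ¬ (Σ (List G) λ xs → ∀ (g : G) → g ∈ xs)

_△_ : {G : Set} → Subset G → Subset G → Subset G
(A △ B) x = (A x × ¬ B x) ⊎ (B x × ¬ A x)

module GroupDefs {G : Set} (_∙_ : G → G → G) where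

  translate : G → Subset G → Subset G
  translate g A x = ∃ λ a → A a × x ≡ g ∙ a

  _·_ : List G → Subset G → Subset G
  (F · A) x = ∃ λ f → f ∈ F × ∃ λ a → A a × x ≡ f ∙ a

  module _ (𝓘 : Family G) where

    record IsIdeal : Set₁ where
      field
        empty-∈  : 𝓘 ∅
        subset-∈ : ∀ {A B : Subset G} → A ⊆ B → 𝓘 B → 𝓘 A
        union-∈  : ∀ {A B : Subset G} → 𝓘 A → 𝓘 B → 𝓘 (A ∪ B)

    TranslationInvariant : Set₁
    TranslationInvariant = ∀ (g : G) (I : Subset G) → 𝓘 I → 𝓘 (translate g I)

    Proper : Set
    Proper = ¬ 𝓘 U

    _=ᴵ_ : Subset G → Subset G → Set
    A =ᴵ B = 𝓘 (A △ B)

    Large : Subset G → Set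
    Large A = Σ (List G) λ F → (F · A) =ᴵ U

    Small : Subset G → Set₁
    Small A = ∀ (L : Subset G) → Large L → Large (∁ A ∩ L)

    Δ : Subset G → Subset G
    Δ A g = ¬ 𝓘 (translate g A ∩ A)

    ΔLarge : Subset G → Set
    ΔLarge A = Large (Δ A)

-- Since A is not small there is an 𝓘-large L, say F·L =_𝓘 G, such that ∁A ∩ L is
-- not 𝓘-large.  We show that the same finite F then gives F·Δ(A) = G exactly.
-- Suppose some g escapes F·Δ(A): then for every f ∈ F the set f⁻¹gA ∩ A lies in 𝓘.
-- Take z = f l with f ∈ F, l ∈ L ∩ A, and put w = g l.  Either w ∉ F·L, so
-- z ∈ (F g⁻¹)·(F·L △ G); or w = f' l' with l' ∈ L; if l' ∉ A then z ∈ (F g⁻¹ F)·(∁A ∩ L),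
-- and if l' ∈ A then w ∈ gA ∩ f'A = f'(f'⁻¹gA ∩ A), an 𝓘-set.  So E = F ∪ F g⁻¹ F
-- covers G with ∁A ∩ L up to a member of 𝓘, i.e. ∁A ∩ L is large: contradiction.
module Submission where

open import Defs
open import Level using (0ℓ)
open import Relation.Nullary using (¬_)
open import Relation.Binary.PropositionalEquality using (_≡_; refl; sym; trans; cong)
open import Algebra.Structures using (IsGroup)
open import Algebra.Bundles using (Group)
open import Axiom.ExcludedMiddle using (ExcludedMiddle)
open import Axiom.DoubleNegationElimination using (em⇒dne)
open import Relation.Nullary.Decidable.Core using (toSum)
open import Data.Product using (∃; _×_; _,_)
open import Data.Sum using (_⊎_; inj₁; inj₂)
open import Data.Empty using (⊥-elim)
open import Data.Unit using (tt)
open import Data.List using (List; []; _∷_; _++_; map; cartesianProductWith)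
open import Data.List.Relation.Unary.Any using (here; there)
open import Data.List.Membership.Propositional using (_∈_)
open import Data.List.Membership.Propositional.Properties
  using (∈-++⁺ˡ; ∈-++⁺ʳ; ∈-map⁺; ∈-cartesianProductWith⁺)
open import Relation.Unary using (_∩_; _∪_; ∁; U; _⊆_)

module IdealLemmas {G : Set} (_∙_ : G → G → G) {𝓘 : Family G}
                   (ideal : GroupDefs.IsIdeal _∙_ 𝓘) where
  open GroupDefs _∙_
  open IsIdeal ideal

  ⋃-∈ : {X : Set} (xs : List X) (S : X → Subset G) → (∀ {x} → x ∈ xs → 𝓘 (S x)) →
        𝓘 (λ z → ∃ λ x → x ∈ xs × S x z)
  ⋃-∈ []       S S∈ = subset-∈ (λ { (_ , () , _) }) empty-∈
  ⋃-∈ (x ∷ xs) S S∈ = subset-∈ split (union-∈ (S∈ (here refl)) (⋃-∈ xs S (λ m → S∈ (there m))))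
    where
    split : (λ z → ∃ λ y → y ∈ x ∷ xs × S y z) ⊆ S x ∪ (λ z → ∃ λ y → y ∈ xs × S y z)
    split (_ , here refl , s) = inj₁ s
    split (y , there m , s)   = inj₂ (y , m , s)

  ·-∈ : TranslationInvariant 𝓘 → (F : List G) {N : Subset G} → 𝓘 N → 𝓘 (F · N)
  ·-∈ ti F {N} N∈ = ⋃-∈ F (λ f → translate f N) (λ _ → ti _ N N∈)

  large-if-covered : (E : List G) {B N : Subset G} → 𝓘 N → (∀ z → (E · B) z ⊎ N z) →
                     Large 𝓘 B
  large-if-covered E {B} {N} N∈ cover = E , subset-∈ outside N∈
    where
    outside : (E · B) △ U ⊆ N
    outside (inj₁ (_ , z∉U)) = ⊥-elim (z∉U tt)
    outside {z} (inj₂ (_ , z∉EB)) with cover z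
    ... | inj₁ z∈EB = ⊥-elim (z∉EB z∈EB)
    ... | inj₂ z∈N  = z∈N

module GroupLemmas {G : Set} {_∙_ : G → G → G} {ε : G} {_⁻¹ : G → G}
                   (isGroup : IsGroup _≡_ _∙_ ε _⁻¹) where
  open GroupDefs _∙_
  open IsGroup isGroup using (assoc)

  group : Group 0ℓ 0ℓ
  group = record { isGroup = isGroup }

  open import Algebra.Properties.Group group public
    using (\\-leftDividesˡ; \\-leftDividesʳ)

  regroup : ∀ f g l → f ∙ l ≡ (f ∙ (g ⁻¹)) ∙ (g ∙ l)
  regroup f g l = trans (cong (f ∙_) (sym (\\-leftDividesʳ g l))) (sym (assoc f (g ⁻¹) (g ∙ l)))

  ∩-translate : ∀ g h (A : Subset G) →
                translate g A ∩ translate h A ⊆ translate h (translate ((h ⁻¹) ∙ g) A ∩ A)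
  ∩-translate g h A ((a , Aa , z≡ga) , (b , Ab , z≡hb)) = b , ((a , Aa , b≡) , Ab) , z≡hb
    where
    b≡ : b ≡ ((h ⁻¹) ∙ g) ∙ a
    b≡ = trans (sym (\\-leftDividesʳ h b))
           (trans (cong ((h ⁻¹) ∙_) (trans (sym z≡hb) z≡ga)) (sym (assoc (h ⁻¹) g a)))

module Core (lem : ExcludedMiddle 0ℓ) {G : Set} {_∙_ : G → G → G} {ε : G} {_⁻¹ : G → G}
            (isGroup : IsGroup _≡_ _∙_ ε _⁻¹) {𝓘 : Family G}
            (ideal : GroupDefs.IsIdeal _∙_ 𝓘) (ti : GroupDefs.TranslationInvariant _∙_ 𝓘)
            (A : Subset G) where
  open GroupDefs _∙_
  open IsIdeal ideal
  open IdealLemmas _∙_ ideal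
  open GroupLemmas isGroup
  open IsGroup isGroup using (assoc)

  decide : (P : Set) → P ⊎ ¬ P
  decide P = toSum (lem {P})

  dne : {P : Set} → ¬ ¬ P → P
  dne = em⇒dne lem

  complement-large : (L : Subset G) (F : List G) (g : G) → 𝓘 ((F · L) △ U) →
                     (∀ {f} → f ∈ F → 𝓘 (translate ((f ⁻¹) ∙ g) A ∩ A)) →
                     Large 𝓘 (∁ A ∩ L)
  complement-large L F g L-large returns∈ = large-if-covered E exceptional∈ cover
    where
    Fg⁻¹ : List G
    Fg⁻¹ = map (_∙ (g ⁻¹)) F

    E : List G
    E = F ++ cartesianProductWith _∙_ Fg⁻¹ F

    N : Subset G
    N = (F · L) △ U

    K : Subset G
    K w = ∃ λ f' → f' ∈ F × (translate g A ∩ translate f' A) w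

    K∈ : 𝓘 K
    K∈ = subset-∈ (λ { (f' , m , w∈) → f' , m , ∩-translate g f' A w∈ })
                  (⋃-∈ F _ (λ m → ti _ _ (returns∈ m)))

    exceptional : Subset G
    exceptional = N ∪ (Fg⁻¹ · (N ∪ K))

    exceptional∈ : 𝓘 exceptional
    exceptional∈ = union-∈ L-large (·-∈ ti Fg⁻¹ (union-∈ L-large K∈))

    cover-via : ∀ {z f l} → f ∈ F → A l → z ≡ (f ∙ (g ⁻¹)) ∙ (g ∙ l) →
                (E · (∁ A ∩ L)) z ⊎ exceptional z
    cover-via {z} {f} {l} f∈ Al z≡ with decide ((F · L) (g ∙ l))
    ... | inj₂ w∉FL = inj₂ (inj₂ (_ , ∈-map⁺ _ f∈ , g ∙ l , inj₁ (inj₂ (tt , w∉FL)) , z≡))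
    ... | inj₁ (f' , f'∈ , l' , Ll' , w≡) with decide (A l')
    ...   | inj₁ Al'  = inj₂ (inj₂ (_ , ∈-map⁺ _ f∈ , g ∙ l ,
                          inj₂ (f' , f'∈ , (l , Al , refl) , (l' , Al' , w≡)) , z≡))
    ...   | inj₂ l'∉A = inj₁ (_ , ∈-++⁺ʳ F (∈-cartesianProductWith⁺ _∙_ (∈-map⁺ _ f∈) f'∈) ,
                          l' , (l'∉A , Ll') , z≡′)
      where
      z≡′ : z ≡ ((f ∙ (g ⁻¹)) ∙ f') ∙ l'
      z≡′ = trans z≡ (trans (cong ((f ∙ (g ⁻¹)) ∙_) w≡) (sym (assoc (f ∙ (g ⁻¹)) f' l')))

    cover : ∀ z → (E · (∁ A ∩ L)) z ⊎ exceptional z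
    cover z with decide ((F · L) z)
    ... | inj₂ z∉FL = inj₂ (inj₁ (inj₂ (tt , z∉FL)))
    ... | inj₁ (f , f∈ , l , Ll , z≡) with decide (A l)
    ...   | inj₂ l∉A = inj₁ (f , ∈-++⁺ˡ f∈ , l , (l∉A , Ll) , z≡)
    ...   | inj₁ Al  = cover-via f∈ Al (trans z≡ (regroup f g l))

  Δ-covers : (L : Subset G) (F : List G) → 𝓘 ((F · L) △ U) → ¬ Large 𝓘 (∁ A ∩ L) →
             ∀ g → (F · Δ 𝓘 A) g
  Δ-covers L F L-large ¬large g = dne λ g∉FΔ →
    ¬large (complement-large L F g L-large λ {f} f∈ → dne λ f⁻¹g∈Δ →
      g∉FΔ (f , f∈ , (f ⁻¹) ∙ g , f⁻¹g∈Δ , sym (\\-leftDividesˡ f g)))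

  Δ-large-if-not-small : ¬ Small 𝓘 A → Large 𝓘 (Δ 𝓘 A)
  Δ-large-if-not-small ¬small = dne λ ¬Δ-large → ¬small λ L → λ { (F , L-large) →
    dne λ ¬large → ¬Δ-large
      (large-if-covered F empty-∈ (λ g → inj₁ (Δ-covers L F L-large ¬large g))) }

theorem2 : ExcludedMiddle 0ℓ →
    (G : Set) (_∙_ : G → G → G) (ε : G) (_⁻¹ : G → G) →
    IsGroup _≡_ _∙_ ε _⁻¹ → Infinite G →
    (𝓘 : Family G) → GroupDefs.IsIdeal _∙_ 𝓘 →
    GroupDefs.TranslationInvariant _∙_ 𝓘 → GroupDefs.Proper _∙_ 𝓘 →
    (A : Subset G) → ¬ GroupDefs.Small _∙_ 𝓘 A → GroupDefs.ΔLarge _∙_ 𝓘 A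
theorem2 lem G _∙_ ε _⁻¹ isGroup _ 𝓘 ideal ti _ A =
  Core.Δ-large-if-not-small lem isGroup ideal ti A
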